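{- Let $\mathbb{H}$ be a cyclic interval hypergraph on $[n]$ and let $A,B$ be two distinct acyclic orientations of $\mathbb{H}$, with pseudo-join $X=X^{AB}$. Suppose $X$ has a 2-cycle given by some $H\in\mathbb{H}_{\mathrm{cyc}}$ and $H'\in\mathbb{H}_{\mathrm{reg}}$, i.e. $X(H')\in H\setminus\{X(H)\}$ and $X(H)\in H'\setminus\{X(H')\}$. Then $X(H)>X(H')$ and $X(H),X(H')\in H^-$.
   Context: $[x,y]=\{x,\dots,y\}$, $[n]=[1,n]$. A cyclic interval hypergraph $\mathbb{H}$ on $[n]$ is a set of nonempty subsets of $[n]$ containing all singletons, whose non-singleton members are regular, $[i,j]$ with $1\le i<j\le n$, $[i,j]\ne[n]$ (these form $\mathbb{H}_{\mathrm{reg}}$), or cyclic, $H=[j,n]\cup[1,i]$ with $1\le i<j\le n$ (these form $\mathbb{H}_{\mathrm{cyc}}$); for such a cyclic $H$ one writes $H^-=[1,i]$, $H^+=[j,n]$, except that for $H=[n]$ one sets $H^-=[1,n-1]$, $H^+=\{n\}$. An orientation $A$ assigns to each $H\in\mathbb{H}$ a source $A(H)\in H$; a cycle is a sequence $(H_1,\dots,H_k)$, $k\ge2$, with $A(H_{i+1})\in H_i\setminus\{A(H_i)\}$ for $i\in[k-1]$ and $A(H_1)\in H_k\setminus\{A(H_k)\}$; $A$ is acyclic if it has no cycle. Pseudo-join: for distinct acyclic orientations $A,B$ and $H\in\mathbb{H}$ let $H_{AB}=\max\{A(H),B(H)\}$. For $\ell\in H$, an $(H,\ell)$-sequence is a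 sequence $(H_i,h_i)_{i=1}^k$ with $H_i\in\mathbb{H}$, $h_i\in H_i$, $H_1=H$, $h_1=\ell$, $h_i=(H_i)_{AB}$ for $i\ge2$, $h_i\in H_{i+1}$ and $h_i<h_{i+1}$ for $i\in[k-1]$, and $h_k\in H$. Let $X^{AB}(H,\ell)$ be the maximum of $h_k$ over all $(H,\ell)$-sequences and $X^{AB}(H)=\min\{X^{AB}(H,\ell)\mid\ell\in H,\ \ell\ge H_{AB}\}$. -}

module Defs where

open import Data.Nat using (ℕ; zero; suc; _≤_; _<_; _⊔_)
open import Data.Product using (_×_; _,_; ∃; Σ)
open import Data.Sum using (_⊎_)
open import Data.List using (List; []; _∷_; _++_)
open import Relation.Binary.PropositionalEquality using (_≡_; _≢_)
open import Relation.Nullary using (¬_)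
open import Data.Unit using (⊤)

-- A hyperedge code (a , b) over [n]:
--   a ≡ b       : the singleton {a}
--   a < b       : the regular interval [a,b]
--   b < a       : the cyclic interval [a,n] ∪ [1,b]
-- Validity (below) makes codes correspond bijectively to the admissible sets;
-- the whole set [n] is coded (only) as the cyclic edge (n , n-1).
Edge : Set
Edge = ℕ × ℕ

Mem : ℕ → ℕ → Edge → Set
Mem n k (a , b) =
  (a ≤ b × a ≤ k × k ≤ b) ⊎ (b < a × ((a ≤ k × k ≤ n) ⊎ (1 ≤ k × k ≤ b)))

Singleton : ℕ → Edge → Set
Singleton n (a , b) = a ≡ b × 1 ≤ a × a ≤ n

Regular : ℕ → Edge → Set
Regular n (i , j) = 1 ≤ i × i < j × j ≤ n × ¬ (i ≡ 1 × j ≡ n)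

-- cyclic [j,n] ∪ [1,i], 1 ≤ i < j ≤ n, coded (j , i); the set [n]
-- (arising when j = i+1) is coded canonically by j = n, i = n-1
Cyclic : ℕ → Edge → Set
Cyclic n (j , i) = 1 ≤ i × i < j × j ≤ n × (j ≡ suc i → j ≡ n)

-- H⁻ for a cyclic H = (j , i): the set [1,i]  (for [n] this is [1,n-1])
MemMinus : ℕ → Edge → Set
MemMinus k (j , i) = 1 ≤ k × k ≤ i

record CIH (n : ℕ) : Set₁ where
  field
    E          : Edge → Set
    valid      : ∀ e → E e → Singleton n e ⊎ Regular n e ⊎ Cyclic n e
    singletons : ∀ k → 1 ≤ k → k ≤ n → E (k , k)
open CIH public

Orientation : Set
Orientation = Edge → ℕ

-- A is an orientation of ℍ: A(H) ∈ H for all H ∈ ℍ (values off ℍ irrelevant)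
IsOrientation : ∀ {n} → CIH n → Orientation → Set
IsOrientation {n} ℍ A = ∀ e → E ℍ e → Mem n (A e) e

Step : ℕ → Orientation → Edge → Edge → Set
Step n A x y = Mem n (A y) x × A y ≢ A x

Linked : ℕ → Orientation → List Edge → Set
Linked n A [] = ⊤
Linked n A (x ∷ []) = ⊤
Linked n A (x ∷ y ∷ t) = Step n A x y × Linked n A (y ∷ t)

data AllE {n : ℕ} (ℍ : CIH n) : List Edge → Set where
  []  : AllE ℍ []
  _∷_ : ∀ {x xs} → E ℍ x → AllE ℍ xs → AllE ℍ (x ∷ xs)

IsCycle : ∀ {n} → CIH n → Orientation → Edge → Edge → List Edge → Set
IsCycle {n} ℍ A H₁ H₂ rest =
  AllE ℍ (H₁ ∷ H₂ ∷ rest) × Linked n A ((H₁ ∷ H₂ ∷ rest) ++ (H₁ ∷ []))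

Acyclic : ∀ {n} → CIH n → Orientation → Set
Acyclic ℍ A = ∀ H₁ H₂ rest → ¬ IsCycle ℍ A H₁ H₂ rest

Distinct : ∀ {n} → CIH n → Orientation → Orientation → Set
Distinct ℍ A B = ∃ λ e → E ℍ e × A e ≢ B e

AB : Orientation → Orientation → Edge → ℕ
AB A B e = A e ⊔ B e

-- tails of an (H,ℓ)-sequence: Path h e means there are (H_i,h_i)_{i=2}^k
-- continuing from the current value h (= h_1 or later), with last value e
data Path {n : ℕ} (ℍ : CIH n) (A B : Orientation) : ℕ → ℕ → Set where
  stop : ∀ {h} → Path ℍ A B h h
  step : ∀ {h e} (H' : Edge) → E ℍ H' → Mem n (AB A B H') H' →
         Mem n h H' → h < AB A B H' → Path ℍ A B (AB A B H') e → Path ℍ A B h e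

SeqEnd : ∀ {n} → CIH n → Orientation → Orientation → Edge → ℕ → ℕ → Set
SeqEnd {n} ℍ A B H ℓ e = Mem n ℓ H × Path ℍ A B ℓ e × Mem n e H

IsXl : ∀ {n} → CIH n → Orientation → Orientation → Edge → ℕ → ℕ → Set
IsXl ℍ A B H ℓ x = SeqEnd ℍ A B H ℓ x × (∀ e → SeqEnd ℍ A B H ℓ e → e ≤ x)

IsX : ∀ {n} → CIH n → Orientation → Orientation → Edge → ℕ → Set
IsX {n} ℍ A B H x =
  (∃ λ ℓ → Mem n ℓ H × AB A B H ≤ ℓ × IsXl ℍ A B H ℓ x) ×
  (∀ ℓ y → Mem n ℓ H → AB A B H ≤ ℓ → IsXl ℍ A B H ℓ y → x ≤ y)

{-# OPTIONS --safe #-}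
module Submission where

-- Write x = X(H) and x' = X(H'), and suppose x < x'.  An (H',ℓ)-sequence
-- starting just above x (and above H'_AB) has, by minimality of x', a maximal
-- end y ≥ x', so it passes x'.  If it lands on x', then x' ∈ H is reachable
-- from x, against the maximality of x.  Otherwise one step jumps over x' via
-- an edge G.  If x' ∈ G, then y is reachable from x' and y ≤ x'; so G is
-- cyclic with x' in its gap.  The orientation (A or B) giving G_AB then has a
-- 2- or 3-cycle among H, H' and G.  Swapping the roles of H and H', the same
-- argument shows x ∉ H⁺, and x' ∈ H⁻ follows from x' < x.

open import Defs
open import Data.Nat using (ℕ; zero; suc; _<_; _≤_; z≤n)
open import Data.Nat.Properties
open import Data.Product using (_×_; _,_; ∃; proj₁; proj₂)
open import Data.Sum using (_⊎_; inj₁; inj₂; [_,_]′)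
open import Data.Empty using (⊥; ⊥-elim)
open import Data.Unit using (tt)
open import Data.List using ([]; _∷_)
open import Relation.Nullary using (¬_; yes; no)
open import Relation.Nullary.Decidable using (¬¬-excluded-middle)
open import Relation.Binary.PropositionalEquality using (_≡_; _≢_; refl; sym; subst)

¬¬-bounded-maximum : (P : ℕ → Set) {m : ℕ} (N : ℕ) → P m → (∀ e → P e → e ≤ N) →
                     ¬ ¬ (∃ λ x → P x × (∀ e → P e → e ≤ x))
¬¬-bounded-maximum P zero    Pm bounded ¬max =
  ¬max (_ , Pm , λ e Pe → ≤-trans (bounded e Pe) z≤n)
¬¬-bounded-maximum P (suc N) Pm bounded ¬max = ¬¬-excluded-middle λ
  { (yes PN) → ¬max (suc N , PN , bounded)
  ; (no ¬PN) → ¬¬-bounded-maximum P N Pm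
      (λ e Pe → m<1+n⇒m≤n (≤∧≢⇒< (bounded e Pe) λ { refl → ¬PN Pe })) ¬max
  }

MemPlus : ℕ → ℕ → Edge → Set
MemPlus n k (j , i) = j ≤ k × k ≤ n

module _ {n : ℕ} where

  Mem-interval : ∀ {a b k} → a ≤ k → k ≤ b → Mem n k (a , b)
  Mem-interval a≤k k≤b = inj₁ (≤-trans a≤k k≤b , a≤k , k≤b)

  Mem-interval⁻ : ∀ {a b k} → a ≤ b → Mem n k (a , b) → a ≤ k × k ≤ b
  Mem-interval⁻ _   (inj₁ (_ , k∈H)) = k∈H
  Mem-interval⁻ a≤b (inj₂ (b<a , _)) = ⊥-elim (<⇒≱ b<a a≤b)

  Mem-plus : ∀ {j i k} → i < j → MemPlus n k (j , i) → Mem n k (j , i)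
  Mem-plus i<j k∈H⁺ = inj₂ (i<j , inj₁ k∈H⁺)

  Mem-minus : ∀ {j i k} → i < j → MemMinus k (j , i) → Mem n k (j , i)
  Mem-minus i<j k∈H⁻ = inj₂ (i<j , inj₂ k∈H⁻)

  Mem-cyclic⁻ : ∀ {j i k} → i < j → Mem n k (j , i) → MemPlus n k (j , i) ⊎ MemMinus k (j , i)
  Mem-cyclic⁻ i<j (inj₁ (j≤i , _)) = ⊥-elim (<⇒≱ i<j j≤i)
  Mem-cyclic⁻ i<j (inj₂ (_ , k∈H)) = k∈H

  Mem⇒MemMinus : ∀ {j i k} → i < j → Mem n k (j , i) → k ≤ i → MemMinus k (j , i)
  Mem⇒MemMinus i<j k∈H k≤i with Mem-cyclic⁻ i<j k∈H
  ... | inj₁ (j≤k , _) = ⊥-elim (<⇒≱ i<j (≤-trans j≤k k≤i))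
  ... | inj₂ k∈H⁻      = k∈H⁻

  Mem-1≤ : ∀ {a b k} → 1 ≤ a → Mem n k (a , b) → 1 ≤ k
  Mem-1≤ 1≤a (inj₁ (_ , a≤k , _))         = ≤-trans 1≤a a≤k
  Mem-1≤ 1≤a (inj₂ (_ , inj₁ (a≤k , _))) = ≤-trans 1≤a a≤k
  Mem-1≤ 1≤a (inj₂ (_ , inj₂ (1≤k , _))) = 1≤k

  Mem-≤ : ∀ {a b k} → b ≤ n → Mem n k (a , b) → k ≤ n
  Mem-≤ b≤n (inj₁ (_ , _ , k≤b))         = ≤-trans k≤b b≤n
  Mem-≤ b≤n (inj₂ (_ , inj₁ (_ , k≤n))) = k≤n
  Mem-≤ b≤n (inj₂ (_ , inj₂ (_ , k≤b))) = ≤-trans k≤b b≤n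

  Mem-between : ∀ {a b h t M} → Mem n h (a , b) → Mem n M (a , b) → h < t → t < M →
                Mem n t (a , b) ⊎ (b < a × MemMinus h (a , b) × b < t × MemPlus n M (a , b))
  Mem-between (inj₁ (_ , a≤h , _)) (inj₁ (_ , _ , M≤b)) h<t t<M =
    inj₁ (Mem-interval (≤-trans a≤h (<⇒≤ h<t)) (≤-trans (<⇒≤ t<M) M≤b))
  Mem-between (inj₁ (a≤b , _)) (inj₂ (b<a , _)) _ _ = ⊥-elim (<⇒≱ b<a a≤b)
  Mem-between (inj₂ (b<a , _)) (inj₁ (a≤b , _)) _ _ = ⊥-elim (<⇒≱ b<a a≤b)
  Mem-between (inj₂ (b<a , inj₁ (a≤h , _))) (inj₂ (_ , inj₁ (_ , M≤n))) h<t t<M =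
    inj₁ (Mem-plus b<a (≤-trans a≤h (<⇒≤ h<t) , ≤-trans (<⇒≤ t<M) M≤n))
  Mem-between (inj₂ (b<a , inj₁ (a≤h , _))) (inj₂ (_ , inj₂ (_ , M≤b))) h<t t<M =
    ⊥-elim (<⇒≱ b<a (≤-trans a≤h (≤-trans (<⇒≤ (<-trans h<t t<M)) M≤b)))
  Mem-between (inj₂ (b<a , inj₂ (1≤h , _))) (inj₂ (_ , inj₂ (_ , M≤b))) h<t t<M =
    inj₁ (Mem-minus b<a (≤-trans 1≤h (<⇒≤ h<t) , ≤-trans (<⇒≤ t<M) M≤b))
  Mem-between (inj₂ (b<a , inj₂ h∈⁻@(1≤h , _))) (inj₂ (_ , inj₁ M∈⁺)) h<t t<M =
    [ (λ t≤b → inj₁ (Mem-minus b<a (≤-trans 1≤h (<⇒≤ h<t) , t≤b)))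
    , (λ b<t → inj₂ (b<a , h∈⁻ , b<t , M∈⁺))
    ]′ (≤-<-connex _ _)

module _ {n : ℕ} (ℍ : CIH n) where

  E-Mem-≤ : ∀ {K k} → E ℍ K → Mem n k K → k ≤ n
  E-Mem-≤ {a , b} K∈ k∈K with valid ℍ (a , b) K∈
  ... | inj₁ (refl , _ , a≤n)             = Mem-≤ a≤n k∈K
  ... | inj₂ (inj₁ (_ , _ , b≤n , _))     = Mem-≤ b≤n k∈K
  ... | inj₂ (inj₂ (_ , b<a , a≤n , _))   = Mem-≤ (<⇒≤ (<-≤-trans b<a a≤n)) k∈K

  module _ {C : Orientation} (orient : IsOrientation ℍ C) (acyclic : Acyclic ℍ C) where

    no-2-cycle : ∀ {G₁ G₂} → E ℍ G₁ → E ℍ G₂ → Step n C G₁ G₂ → Step n C G₂ G₁ → ⊥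
    no-2-cycle {G₁} {G₂} G₁∈ G₂∈ s₁₂ s₂₁ =
      acyclic G₁ G₂ [] ((G₁∈ ∷ G₂∈ ∷ []) , s₁₂ , s₂₁ , tt)

    no-3-cycle : ∀ {G₁ G₂ G₃} → E ℍ G₁ → E ℍ G₂ → E ℍ G₃ →
                 Step n C G₁ G₂ → Step n C G₂ G₃ → Step n C G₃ G₁ → ⊥
    no-3-cycle {G₁} {G₂} {G₃} G₁∈ G₂∈ G₃∈ s₁₂ s₂₃ s₃₁ =
      acyclic G₁ G₂ (G₃ ∷ []) ((G₁∈ ∷ G₂∈ ∷ G₃∈ ∷ []) , s₁₂ , s₂₃ , s₃₁ , tt)

    no-overpass-into-regular :
      ∀ {j i a b g₁ g₂ x'} → E ℍ (j , i) → E ℍ (a , b) → E ℍ (g₁ , g₂) →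
      1 ≤ i → i < j → 1 ≤ a → g₂ < g₁ →
      C (j , i) ≤ g₂ → a ≤ g₂ → g₂ < x' → x' ≤ i →
      C (a , b) ≤ x' → x' < C (g₁ , g₂) → C (g₁ , g₂) ≤ b → ⊥
    no-overpass-into-regular {j} {i} {a} {b} {g₁} {g₂}
      H∈ H'∈ G∈ 1≤i i<j 1≤a g₂<g₁ CH≤g₂ a≤g₂ g₂<x' x'≤i CH'≤x' x'<CG CG≤b =
      [ two-cycle , three-cycle ]′ (≤-<-connex (C (a , b)) g₂)
      where
        1≤CH : 1 ≤ C (j , i)
        1≤CH = Mem-1≤ (≤-trans 1≤i (<⇒≤ i<j)) (orient (j , i) H∈)

        1≤CH' : 1 ≤ C (a , b)
        1≤CH' = Mem-1≤ 1≤a (orient (a , b) H'∈)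

        CH'<CG : C (a , b) < C (g₁ , g₂)
        CH'<CG = ≤-<-trans CH'≤x' x'<CG

        H'→G : Step n C (a , b) (g₁ , g₂)
        H'→G = Mem-interval (≤-trans a≤g₂ (<⇒≤ (<-trans g₂<x' x'<CG))) CG≤b , >⇒≢ CH'<CG

        two-cycle : C (a , b) ≤ g₂ → ⊥
        two-cycle CH'≤g₂ =
          no-2-cycle G∈ H'∈ (Mem-minus g₂<g₁ (1≤CH' , CH'≤g₂) , <⇒≢ CH'<CG) H'→G

        three-cycle : g₂ < C (a , b) → ⊥
        three-cycle g₂<CH' = no-3-cycle H∈ H'∈ G∈
          (Mem-minus i<j (1≤CH' , ≤-trans CH'≤x' x'≤i) , >⇒≢ (≤-<-trans CH≤g₂ g₂<CH'))
          H'→G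
          (Mem-minus g₂<g₁ (1≤CH , CH≤g₂) , <⇒≢ (≤-<-trans CH≤g₂ (<-trans g₂<x' x'<CG)))

    no-overpass-into-cyclic⁺ :
      ∀ {j i a b g₁ g₂ x} → E ℍ (j , i) → E ℍ (a , b) → E ℍ (g₁ , g₂) →
      1 ≤ i → i < j → 1 ≤ a → a < b → g₂ < g₁ →
      C (a , b) ≤ g₂ → g₂ < x → C (j , i) ≤ x → x ≤ b → x < C (g₁ , g₂) →
      MemPlus n (C (g₁ , g₂)) (j , i) → ⊥
    no-overpass-into-cyclic⁺ {j} {i} {a} {b} {g₁} {g₂}
      H∈ H'∈ G∈ 1≤i i<j 1≤a a<b g₂<g₁ CH'≤g₂ g₂<x CH≤x x≤b x<CG CG∈H⁺ =
      [ two-cycle , three-cycle ]′ (≤-<-connex (C (j , i)) g₂)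
      where
        1≤CH : 1 ≤ C (j , i)
        1≤CH = Mem-1≤ (≤-trans 1≤i (<⇒≤ i<j)) (orient (j , i) H∈)

        CH'∈H' : a ≤ C (a , b) × C (a , b) ≤ b
        CH'∈H' = Mem-interval⁻ (<⇒≤ a<b) (orient (a , b) H'∈)

        CH<CG : C (j , i) < C (g₁ , g₂)
        CH<CG = ≤-<-trans CH≤x x<CG

        H→G : Step n C (j , i) (g₁ , g₂)
        H→G = Mem-plus i<j CG∈H⁺ , >⇒≢ CH<CG

        two-cycle : C (j , i) ≤ g₂ → ⊥
        two-cycle CH≤g₂ = no-2-cycle H∈ G∈ H→G (Mem-minus g₂<g₁ (1≤CH , CH≤g₂) , <⇒≢ CH<CG)

        three-cycle : g₂ < C (j , i) → ⊥
        three-cycle g₂<CH = no-3-cycle H∈ G∈ H'∈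
          H→G
          (Mem-minus g₂<g₁ (≤-trans 1≤a (proj₁ CH'∈H') , CH'≤g₂) ,
           <⇒≢ (≤-<-trans CH'≤g₂ (<-trans g₂<x x<CG)))
          (Mem-interval (≤-trans (proj₁ CH'∈H') (<⇒≤ CH'<CH)) (≤-trans CH≤x x≤b) , >⇒≢ CH'<CH)
          where
            CH'<CH : C (a , b) < C (j , i)
            CH'<CH = ≤-<-trans CH'≤g₂ g₂<CH

module _ {n : ℕ} {ℍ : CIH n} {A B : Orientation} where

  Path-≤ : ∀ {h e} → Path ℍ A B h e → h ≤ e
  Path-≤ stop                     = ≤-refl
  Path-≤ (step _ _ _ _ h<M M→e) = ≤-trans (<⇒≤ h<M) (Path-≤ M→e)

  infixr 5 _++ₚ_
  _++ₚ_ : ∀ {h m e} → Path ℍ A B h m → Path ℍ A B m e → Path ℍ A B h e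
  stop                   ++ₚ q = q
  step G G∈ M∈ h∈ h<M p ++ₚ q = step G G∈ M∈ h∈ h<M (p ++ₚ q)

  data Crossing (p t y : ℕ) : Set where
    reaches : Path ℍ A B p t → Crossing p t y
    leaps   : ∀ {h} (G : Edge) → E ℍ G → Mem n h G → Mem n (AB A B G) G →
              h < t → t < AB A B G → Path ℍ A B p h → Path ℍ A B (AB A B G) y →
              Crossing p t y

  Crossing-step : ∀ {p t y} (G : Edge) → E ℍ G → Mem n (AB A B G) G → Mem n p G →
                  p < AB A B G → Crossing (AB A B G) t y → Crossing p t y
  Crossing-step G G∈ M∈ p∈ p<M (reaches M→t) = reaches (step G G∈ M∈ p∈ p<M M→t)
  Crossing-step G G∈ M∈ p∈ p<M (leaps G' G'∈ h∈ M'∈ h<t t<M' M→h M'→y) =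
    leaps G' G'∈ h∈ M'∈ h<t t<M' (step G G∈ M∈ p∈ p<M M→h) M'→y

  crossing : ∀ {p y} t → p ≤ t → t ≤ y → Path ℍ A B p y → Crossing p t y
  crossing t p≤t t≤y stop with ≤-antisym p≤t t≤y
  ... | refl = reaches stop
  crossing t p≤t t≤y (step G G∈ M∈ p∈ p<M M→y) with ≤-<-connex (AB A B G) t
  ... | inj₁ M≤t = Crossing-step G G∈ M∈ p∈ p<M (crossing t M≤t t≤y M→y)
  ... | inj₂ t<M with m≤n⇒m<n∨m≡n p≤t
  ...   | inj₁ p<t  = leaps G G∈ p∈ M∈ p<t t<M stop M→y
  ...   | inj₂ refl = reaches stop

  IsX⇒AB≤ : ∀ {K u} → IsX ℍ A B K u → AB A B K ≤ u
  IsX⇒AB≤ ((_ , _ , AB≤ℓ , (_ , ℓ→u , _) , _) , _) = ≤-trans AB≤ℓ (Path-≤ ℓ→u)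

  IsX-Mem : ∀ {K u} → IsX ℍ A B K u → Mem n u K
  IsX-Mem ((_ , _ , _ , (_ , _ , u∈K) , _) , _) = u∈K

  IsX-maximal : ∀ {K u e} → IsX ℍ A B K u → Path ℍ A B u e → Mem n e K → e ≤ u
  IsX-maximal ((_ , _ , _ , (ℓ∈K , ℓ→u , _) , maximal) , _) u→e e∈K =
    maximal _ (ℓ∈K , ℓ→u ++ₚ u→e , e∈K)

module _ {n : ℕ} {ℍ : CIH n} {A B : Orientation}
         (orientA : IsOrientation ℍ A) (acyclicA : Acyclic ℍ A)
         (orientB : IsOrientation ℍ B) (acyclicB : Acyclic ℍ B) where

  AB-attained : ∀ G → ∃ λ C → IsOrientation ℍ C × Acyclic ℍ C ×
                              (∀ K → C K ≤ AB A B K) × C G ≡ AB A B G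
  AB-attained G with ⊔-sel (A G) (B G)
  ... | inj₁ AB≡A = A , orientA , acyclicA , (λ K → m≤m⊔n (A K) (B K)) , sym AB≡A
  ... | inj₂ AB≡B = B , orientB , acyclicB , (λ K → m≤n⊔m (A K) (B K)) , sym AB≡B

  AB-Mem : ∀ G → E ℍ G → Mem n (AB A B G) G
  AB-Mem G G∈ with AB-attained G
  ... | C , orient , _ , _ , CG≡AB = subst (λ v → Mem n v G) CG≡AB (orient G G∈)

  IsX-entry : ∀ {K u u'} → E ℍ K → IsX ℍ A B K u' → Mem n u K → u ≤ u' →
              ∃ λ ℓ → Mem n ℓ K × AB A B K ≤ ℓ × ℓ ≤ u' × Path ℍ A B u ℓ
  IsX-entry {K} {u} K∈ X[K] u∈K u≤u' with ≤-<-connex (AB A B K) u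
  ... | inj₁ AB≤u = u , u∈K , AB≤u , u≤u' , stop
  ... | inj₂ u<AB = AB A B K , AB-Mem K K∈ , ≤-refl , IsX⇒AB≤ X[K] ,
                    step K K∈ (AB-Mem K K∈) u∈K u<AB stop

  record Overpass (K K' : Edge) (u u' : ℕ) : Set where
    field
      g₁ g₂  : ℕ
      G∈ℍ    : E ℍ (g₁ , g₂)
      cyclic : g₂ < g₁
      u≤g₂   : u ≤ g₂
      g₂<u'  : g₂ < u'
      u'<top : u' < AB A B (g₁ , g₂)
      top≤n  : AB A B (g₁ , g₂) ≤ n
      top∉K  : ¬ Mem n (AB A B (g₁ , g₂)) K
      top≤K' : ∃ λ y → Mem n y K' × AB A B (g₁ , g₂) ≤ y

  overpass : ∀ {K K' u u'} → E ℍ K' → IsX ℍ A B K u → IsX ℍ A B K' u' →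
             Mem n u K' → Mem n u' K → u < u' → ¬ ¬ Overpass K K' u u'
  overpass {K' = K'} {u} {u'} K'∈ X[K] X[K'] u∈K' u'∈K u<u' ¬overpass =
    let ℓ , ℓ∈K' , AB≤ℓ , ℓ≤u' , u→ℓ = IsX-entry K'∈ X[K'] u∈K' (<⇒≤ u<u') in
    -- E ℍ is an arbitrary predicate, so X(K',ℓ) exists only classically;
    -- the goal ⊥ permits that.
    ¬¬-bounded-maximum (SeqEnd ℍ A B K' ℓ) n (ℓ∈K' , stop , ℓ∈K')
      (λ _ (_ , _ , e∈K') → E-Mem-≤ ℍ K'∈ e∈K')
      λ { (y , X[K',ℓ]@((_ , ℓ→y , y∈K') , _)) →
          pass u→ℓ (crossing u' ℓ≤u' (proj₂ X[K'] ℓ y ℓ∈K' AB≤ℓ X[K',ℓ]) ℓ→y) y∈K' }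
    where
      pass : ∀ {ℓ y} → Path ℍ A B u ℓ → Crossing ℓ u' y → Mem n y K' → ⊥
      pass u→ℓ (reaches ℓ→u') _ = <⇒≱ u<u' (IsX-maximal X[K] (u→ℓ ++ₚ ℓ→u') u'∈K)
      pass u→ℓ (leaps (g₁ , g₂) G∈ h∈G top∈G h<u' u'<top ℓ→h top→y) y∈K'
        with Mem-between h∈G top∈G h<u' u'<top
      ... | inj₁ u'∈G = <⇒≱ (<-≤-trans u'<top (Path-≤ top→y))
                          (IsX-maximal X[K'] (step _ G∈ top∈G u'∈G u'<top top→y) y∈K')
      ... | inj₂ (g₂<g₁ , (_ , h≤g₂) , g₂<u' , (_ , top≤n)) = ¬overpass record
        { G∈ℍ    = G∈
        ; cyclic = g₂<g₁
        ; u≤g₂   = ≤-trans (Path-≤ (u→ℓ ++ₚ ℓ→h)) h≤g₂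
        ; g₂<u'  = g₂<u'
        ; u'<top = u'<top
        ; top≤n  = top≤n
        ; top∉K  = λ top∈K → <⇒≱ (<-trans u<u' u'<top) (IsX-maximal X[K]
                     (u→ℓ ++ₚ ℓ→h ++ₚ step _ G∈ top∈G h∈G (<-trans h<u' u'<top) stop) top∈K)
        ; top≤K' = _ , y∈K' , Path-≤ top→y
        }

  open Overpass

  module TwoCycle {j i a b x x'}
           (H∈ : E ℍ (j , i)) (1≤i : 1 ≤ i) (i<j : i < j)
           (H'∈ : E ℍ (a , b)) (1≤a : 1 ≤ a) (a<b : a < b)
           (X[H] : IsX ℍ A B (j , i) x) (X[H'] : IsX ℍ A B (a , b) x')
           (x'∈H : Mem n x' (j , i)) (x∈H' : Mem n x (a , b)) where

    private
      x∈[a,b] : a ≤ x × x ≤ b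
      x∈[a,b] = Mem-interval⁻ (<⇒≤ a<b) x∈H'

    X-regular≤X-cyclic : x' ≤ x
    X-regular≤X-cyclic = ≮⇒≥ λ x<x' → overpass H'∈ X[H] X[H'] x∈H' x'∈H x<x' impossible
      where
        impossible : Overpass (j , i) (a , b) x x' → ⊥
        impossible o with Mem-cyclic⁻ i<j x'∈H | AB-attained (g₁ o , g₂ o) | top≤K' o
        ... | inj₁ (j≤x' , _) | _ | _ =
          top∉K o (Mem-plus i<j (≤-trans j≤x' (<⇒≤ (u'<top o)) , top≤n o))
        ... | inj₂ (_ , x'≤i) | C , orient , acyclic , C≤AB , CG≡AB | _ , y∈H' , top≤y =
          no-overpass-into-regular ℍ orient acyclic H∈ H'∈ (G∈ℍ o) 1≤i i<j 1≤a (cyclic o)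
            (≤-trans (C≤AB (j , i)) (≤-trans (IsX⇒AB≤ X[H]) (u≤g₂ o)))
            (≤-trans (proj₁ x∈[a,b]) (u≤g₂ o)) (g₂<u' o) x'≤i
            (≤-trans (C≤AB (a , b)) (IsX⇒AB≤ X[H']))
            (subst (x' <_) (sym CG≡AB) (u'<top o))
            (subst (_≤ b) (sym CG≡AB) (≤-trans top≤y (proj₂ (Mem-interval⁻ (<⇒≤ a<b) y∈H'))))

    X-cyclic∈H⁻ : x' < x → MemMinus x (j , i)
    X-cyclic∈H⁻ x'<x with Mem-cyclic⁻ i<j (IsX-Mem X[H])
    ... | inj₂ x∈H⁻       = x∈H⁻
    ... | inj₁ (j≤x , _) = ⊥-elim (overpass H∈ X[H'] X[H] x'∈H x∈H' x'<x impossible)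
      where
        impossible : Overpass (a , b) (j , i) x' x → ⊥
        impossible o with AB-attained (g₁ o , g₂ o)
        ... | C , orient , acyclic , C≤AB , CG≡AB =
          no-overpass-into-cyclic⁺ ℍ orient acyclic H∈ H'∈ (G∈ℍ o) 1≤i i<j 1≤a a<b (cyclic o)
            (≤-trans (C≤AB (a , b)) (≤-trans (IsX⇒AB≤ X[H']) (u≤g₂ o)))
            (g₂<u' o) (≤-trans (C≤AB (j , i)) (IsX⇒AB≤ X[H])) (proj₂ x∈[a,b])
            (subst (x <_) (sym CG≡AB) (u'<top o))
            (subst (λ v → MemPlus n v (j , i)) (sym CG≡AB)
              (≤-trans j≤x (<⇒≤ (u'<top o)) , top≤n o))

lemma5p7 : (n : ℕ) (ℍ : CIH n) (A B : Orientation) →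
    IsOrientation ℍ A → Acyclic ℍ A → IsOrientation ℍ B → Acyclic ℍ B →
    Distinct ℍ A B →
    (H H' : Edge) → E ℍ H → Cyclic n H → E ℍ H' → Regular n H' →
    (x x' : ℕ) → IsX ℍ A B H x → IsX ℍ A B H' x' →
    Mem n x' H → x' ≢ x → Mem n x H' → x ≢ x' →
    x' < x × MemMinus x H × MemMinus x' H
lemma5p7 n ℍ A B orientA acyclicA orientB acyclicB _ (j , i) (a , b) H∈ (1≤i , i<j , _)
         H'∈ (1≤a , a<b , _) x x' X[H] X[H'] x'∈H x'≢x x∈H' _ = x'<x , x∈H⁻ , x'∈H⁻
  where
    open TwoCycle orientA acyclicA orientB acyclicB
                  H∈ 1≤i i<j H'∈ 1≤a a<b X[H] X[H'] x'∈H x∈H'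

    x'<x : x' < x
    x'<x = ≤∧≢⇒< X-regular≤X-cyclic x'≢x

    x∈H⁻ : MemMinus x (j , i)
    x∈H⁻ = X-cyclic∈H⁻ x'<x

    x'∈H⁻ : MemMinus x' (j , i)
    x'∈H⁻ = Mem⇒MemMinus i<j x'∈H (≤-trans (<⇒≤ x'<x) (proj₂ x∈H⁻))
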